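{- Let $G$ be a locally finite graph, let $r$ be a positive integer, let $\{f_n\}_{n\ge1}$ be a sequence of non-negative integers, let $X_0$ be a finite set of vertices of $G$, and let $\{W_k\}_{k\geq 1}$ be a sequence of sets of vertices of $G$. For $n>0$ let $X_n$ be the set of vertices of $G$ connected to a vertex of $X_{n-1}$ by a path of length at most $r$ containing no vertex of $W_1\cup\cdots\cup W_n$. Suppose that $|W_n|\le f_n$ for every $n\ge 1$ and that $X_n\cap W_{n+1}=\emptyset$ for every $n\ge 0$. Then the following are equivalent: (i) there is $N>0$ such that $X_n=X_N$ for every $n\geq N$; (ii) there is $N>0$ such that $X_n\subseteq B_G(X_0, rN)$ for every $n\geq 0$. Consequently, in the definition of an $(\{f_n\},r)$-containment strategy for $X_0$ (for locally finite $G$), condition (i) may be replaced by condition (ii).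
   Context: A graph is locally finite if every vertex has finite degree. A path of length $n$ is a sequence of vertices $v_0,\dots,v_n$ with $v_i,v_{i+1}$ adjacent. $\mathrm{dist}_G$ denotes the combinatorial metric (length of a shortest path), and for a set $X$ of vertices, $B_G(X,\rho)$ is the set of vertices at distance at most $\rho$ from some vertex of $X$. A sequence $\{W_k\}$ satisfying $|W_n|\le f_n$, $X_n\cap W_{n+1}=\emptyset$ for $n\ge0$ (with $X_n$ defined as in the claim), and (i) is called an $(\{f_n\},r)$-containment strategy for $X_0$. -}

module Defs where

open import Level using (0ℓ)
open import Data.Nat using (ℕ; zero; suc; _≤_)
open import Data.Fin using (Fin; zero; suc; fromℕ; inject₁)
open import Data.List using (List; length)
open import Data.List.Membership.Propositional using (_∈_)
open import Data.List.Relation.Unary.Unique.Propositional using (Unique)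
open import Data.Product using (Σ; ∃; _×_; _,_)
open import Relation.Nullary using (¬_)
open import Relation.Unary using (Pred)
open import Relation.Binary.PropositionalEquality using (_≡_)

record Graph : Set₁ where
  field
    V      : Set
    E      : V → V → Set
    E-sym  : ∀ {u v} → E u v → E v u
    E-irr  : ∀ {v} → ¬ E v v

module _ (G : Graph) where
  open Graph G

  FiniteSet : Pred V 0ℓ → Set
  FiniteSet X = Σ (List V) λ l → ∀ v → (X v → v ∈ l) × (v ∈ l → X v)

  CardLe : Pred V 0ℓ → ℕ → Set
  CardLe X m = Σ (List V) λ l → Unique l × (∀ v → (X v → v ∈ l) × (v ∈ l → X v)) × length l ≤ m

  LocallyFinite : Set
  LocallyFinite = ∀ v → FiniteSet (E v)

  -- p : Fin (suc n) → V is a path v_0,…,v_n of length n from u to w.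
  IsPath : (n : ℕ) → (Fin (suc n) → V) → V → V → Set
  IsPath n p u w = (p zero ≡ u) × (p (fromℕ n) ≡ w) × (∀ (i : Fin n) → E (p (inject₁ i)) (p (suc i)))

  Dist≤ : V → V → ℕ → Set
  Dist≤ u w ρ = ∃ λ k → k ≤ ρ × Σ (Fin (suc k) → V) λ p → IsPath k p u w

  Ball : Pred V 0ℓ → ℕ → Pred V 0ℓ
  Ball X ρ w = ∃ λ u → X u × Dist≤ u w ρ

  -- v ∈ W_1 ∪ ⋯ ∪ W_n   (the sequence W is indexed from 1; W 0 is ignored)
  WUpTo : (ℕ → Pred V 0ℓ) → ℕ → Pred V 0ℓ
  WUpTo W n v = ∃ λ i → 1 ≤ i × i ≤ n × W i v

  Xseq : ℕ → Pred V 0ℓ → (ℕ → Pred V 0ℓ) → ℕ → Pred V 0ℓ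
  Xseq r X0 W zero = X0
  Xseq r X0 W (suc n) w =
    ∃ λ u → Xseq r X0 W n u ×
      (∃ λ k → k ≤ r × Σ (Fin (suc k) → V) λ p →
         IsPath k p u w × (∀ i → ¬ WUpTo W (suc n) (p i)))

-- X_n only grows (X_n ∩ W_{n+1} = ∅ lets each vertex stay put), and every vertex of X_n is
-- the end of a walk of length at most rn from X_0. If the X_n stabilise at N they all lie
-- in B(X_0, rN). Conversely, in a locally finite graph a ball around a finite set is finite,
-- so an increasing chain inside it must stabilise; this last step is where excluded middle
-- is used.
module Submission where

open import Defs
open import Level using (0ℓ)
open import Data.Nat using (ℕ; zero; suc; _≤_; _<_; _≤′_; ≤′-reflexive; ≤′-step; _*_; _+_; z≤n; s≤s)
open import Data.Nat.Properties
open import Data.Fin using (Fin; zero; suc; fromℕ; inject₁)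
open import Data.List using (List; _++_; concatMap; filter; length)
open import Data.List.Properties using (length-filter)
open import Data.List.Membership.Propositional using (_∈_; lose)
open import Data.List.Membership.Propositional.Properties
  using (∈-++⁺ˡ; ∈-++⁺ʳ; ∈-concatMap⁺; ∈-filter⁺; ∈-filter⁻)
open import Data.List.Relation.Binary.Pointwise using (Pointwise-≡⇒≡)
open import Data.List.Relation.Binary.Sublist.Propositional using () renaming (_⊆_ to _⊑_; ⊆-refl to ⊑-refl)
open import Data.List.Relation.Binary.Sublist.Propositional.Properties
  using (filter⁺; length-mono-≤; to-≋)
open import Data.Product using (Σ; ∃; _×_; _,_; proj₁; proj₂)
open import Data.Sum using (inj₁; inj₂)
open import Data.Empty using (⊥-elim)
open import Function using (_∘_)
open import Function.Bundles using (_⇔_; mk⇔)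
open import Relation.Nullary using (Dec; yes; no; ¬_)
open import Relation.Unary using (Pred; _⊆_; _≐_; _∩_; Empty)
open import Relation.Binary.PropositionalEquality using (_≡_; refl; sym; trans; subst)

module _ {A : Set} (P : ℕ → Pred A 0ℓ) where

  ⊆-chain-mono : (∀ n → P n ⊆ P (suc n)) → ∀ {m n} → m ≤ n → P m ⊆ P n
  ⊆-chain-mono step = go ∘ ≤⇒≤′
    where
    go : ∀ {m n} → m ≤′ n → P m ⊆ P n
    go (≤′-reflexive refl) = λ p → p
    go (≤′-step m≤′n) = step _ ∘ go m≤′n

ExcludedMiddle : Set₁
ExcludedMiddle = (P : Set) → Dec P

module _ (em : ExcludedMiddle) where

  monotone-bounded-stabilises :
    (c : ℕ → ℕ) → (∀ {m n} → m ≤ n → c m ≤ c n) → (B : ℕ) → (∀ n → c n ≤ B) →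
    ∀ m → ∃ λ N → m ≤ N × (∀ n → N ≤ n → c n ≡ c N)
  monotone-bounded-stabilises c mono B bound m = go B m (m≤m+n B (c m))
    where
    -- Induction on the room d left below the bound: every strict increase uses some of it.
    go : ∀ d m → B ≤ d + c m → ∃ λ N → m ≤ N × (∀ n → N ≤ n → c n ≡ c N)
    go d m B≤ with em (∃ λ n → m ≤ n × c m < c n)
    ... | no noJump = m , ≤-refl , λ n m≤n →
      ≤-antisym (≮⇒≥ (λ c<c → noJump (n , m≤n , c<c))) (mono m≤n)
    go zero m B≤ | yes (n , _ , c<c) = ⊥-elim (<⇒≱ c<c (≤-trans (bound n) B≤))
    go (suc d) m B≤ | yes (n , m≤n , c<c)
      with go d n (≤-trans B≤ (≤-trans (≤-reflexive (sym (+-suc d (c m)))) (+-monoʳ-≤ d c<c)))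
    ... | N , n≤N , const = N , ≤-trans m≤n n≤N , const

  module _ {A : Set} (P : ℕ → Pred A 0ℓ) (mono : ∀ {m n} → m ≤ n → P m ⊆ P n)
           (L : List A) where

    private
      selected : ℕ → List A
      selected n = filter (λ x → em (P n x)) L

      selected-mono : ∀ {m n} → m ≤ n → selected m ⊑ selected n
      selected-mono {m} {n} m≤n = filter⁺ (λ x → em (P m x)) (λ x → em (P n x)) (λ { refl → mono m≤n }) (⊑-refl {x = L})

    -- The members of P n in L form a sublist of L growing with n; once their number stops
    -- growing the sublists coincide.
    chain-within-list-stabilises : (∀ n → P n ⊆ (_∈ L)) →
      ∀ m → ∃ λ N → m ≤ N × (∀ n → N ≤ n → P n ⊆ P N)
    chain-within-list-stabilises within m
      with monotone-bounded-stabilises (length ∘ selected) (length-mono-≤ ∘ selected-mono)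
             (length L) (λ n → length-filter (λ x → em (P n x)) L) m
    ... | N , m≤N , const = N , m≤N , shrink
      where
      shrink : ∀ n → N ≤ n → P n ⊆ P N
      shrink n N≤n {x} px = proj₂ (∈-filter⁻ (λ y → em (P N y)) {xs = L} x∈selectedN)
        where
        same : selected N ≡ selected n
        same = Pointwise-≡⇒≡ (to-≋ (sym (const n N≤n)) (selected-mono N≤n))
        x∈selectedN : x ∈ selected N
        x∈selectedN = subst (x ∈_) (sym same) (∈-filter⁺ (λ y → em (P n y)) (within n px) px)

module Walks (G : Graph) where
  open Graph G

  data Walk : V → V → ℕ → Set where
    []  : ∀ {u} → Walk u u 0
    _∷_ : ∀ {u v w k} → E u v → Walk v w k → Walk u w (suc k)

  infixr 5 _∷_ _++ᵂ_

  _++ᵂ_ : ∀ {u v w k l} → Walk u v k → Walk v w l → Walk u w (k + l)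
  [] ++ᵂ q = q
  (e ∷ p) ++ᵂ q = e ∷ (p ++ᵂ q)

  path⇒walk : ∀ {u w} k (p : Fin (suc k) → V) → IsPath G k p u w → Walk u w k
  path⇒walk zero p (refl , refl , _) = []
  path⇒walk (suc k) p (refl , p-end , p-edges) =
    p-edges zero ∷ path⇒walk k (p ∘ suc) (refl , p-end , p-edges ∘ suc)

  walk⇒path : ∀ {u w k} → Walk u w k → Σ (Fin (suc k) → V) λ p → IsPath G k p u w
  walk⇒path {u} [] = (λ _ → u) , refl , refl , λ ()
  walk⇒path {u} (_∷_ {k = k} e q) with walk⇒path q
  ... | p , refl , p-end , p-edges = cons , refl , p-end , cons-edges
    where
    cons : Fin (suc (suc k)) → V
    cons zero = u
    cons (suc i) = p i
    cons-edges : ∀ i → E (cons (inject₁ i)) (cons (suc i))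
    cons-edges zero = e
    cons-edges (suc i) = p-edges i

  walk⇒Ball : ∀ {X u w k ρ} → X u → k ≤ ρ → Walk u w k → Ball G X ρ w
  walk⇒Ball {u = u} Xu k≤ρ q = u , Xu , _ , k≤ρ , walk⇒path q

  module _ (lf : LocallyFinite G) where

    neighbours : V → List V
    neighbours v = proj₁ (lf v)

    closedNeighbourhood : List V → List V
    closedNeighbourhood l = l ++ concatMap neighbours l

    ballList : ℕ → List V → List V
    ballList zero l = l
    ballList (suc ρ) l = ballList ρ (closedNeighbourhood l)

    ∈-ballList : ∀ ρ {l u} → u ∈ l → u ∈ ballList ρ l
    ∈-ballList zero u∈l = u∈l
    ∈-ballList (suc ρ) u∈l = ∈-ballList ρ (∈-++⁺ˡ u∈l)

    walk-end-∈-ballList : ∀ ρ {l u w k} → u ∈ l → k ≤ ρ → Walk u w k → w ∈ ballList ρ l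
    walk-end-∈-ballList ρ u∈l _ [] = ∈-ballList ρ u∈l
    walk-end-∈-ballList (suc ρ) {l} {u} u∈l (s≤s k≤ρ) (_∷_ {v = v} e q) =
      walk-end-∈-ballList ρ (∈-++⁺ʳ l (∈-concatMap⁺ neighbours (lose u∈l v∈neighbours))) k≤ρ q
      where
      v∈neighbours : v ∈ neighbours u
      v∈neighbours = proj₁ (proj₂ (lf u) v) e

    Ball-finite : ∀ {X} → FiniteSet G X → ∀ ρ → Σ (List V) λ L → Ball G X ρ ⊆ (_∈ L)
    Ball-finite (l , l-enumerates) ρ =
      ballList ρ l , λ { (u , Xu , k , k≤ρ , p , p-is-path) →
        walk-end-∈-ballList ρ (proj₁ (l-enumerates u) Xu) k≤ρ (path⇒walk k p p-is-path) }

module ContainmentSequence (G : Graph) (r : ℕ) (X0 : Pred (Graph.V G) 0ℓ)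
                           (W : ℕ → Pred (Graph.V G) 0ℓ) where
  open Graph G
  open Walks G

  X : ℕ → Pred V 0ℓ
  X = Xseq G r X0 W

  X-avoids-W : ∀ n {u} → X n u → ¬ WUpTo G W n u
  X-avoids-W zero _ (i , 1≤i , i≤0 , _) = <⇒≱ 1≤i i≤0
  X-avoids-W (suc n) (_ , _ , k , _ , p , (_ , refl , _) , p-avoids) = p-avoids (fromℕ k)

  X-walk-from-X0 : ∀ n {w} → X n w → ∃ λ u → X0 u × ∃ λ k → k ≤ r * n × Walk u w k
  X-walk-from-X0 zero {w} X0w = w , X0w , 0 , z≤n , []
  X-walk-from-X0 (suc n) (v , Xv , k , k≤r , p , p-is-path , _) with X-walk-from-X0 n Xv
  ... | u , X0u , j , j≤rn , q =
    u , X0u , j + k , j+k≤r[1+n] , q ++ᵂ path⇒walk k p p-is-path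
    where
    j+k≤r[1+n] : j + k ≤ r * suc n
    j+k≤r[1+n] = ≤-trans (+-mono-≤ j≤rn k≤r)
                         (≤-reflexive (trans (+-comm (r * n) r) (sym (*-suc r n))))

  X⊆Ball : ∀ n → X n ⊆ Ball G X0 (r * n)
  X⊆Ball n Xw with X-walk-from-X0 n Xw
  ... | u , X0u , k , k≤rn , q = walk⇒Ball X0u k≤rn q

  module _ (disjoint : ∀ n → Empty (X n ∩ W (suc n))) where

    X-⊆-suc : ∀ n → X n ⊆ X (suc n)
    X-⊆-suc n {u} Xu = u , Xu , 0 , z≤n , (λ _ → u) , (refl , refl , λ ()) , λ _ → stays
      where
      stays : ¬ WUpTo G W (suc n) u
      stays (i , 1≤i , i≤1+n , Wiu) with m≤n⇒m<n∨m≡n i≤1+n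
      ... | inj₁ (s≤s i≤n) = X-avoids-W n Xu (i , 1≤i , i≤n , Wiu)
      ... | inj₂ refl = disjoint n u (Xu , Wiu)

    X-mono : ∀ {m n} → m ≤ n → X m ⊆ X n
    X-mono = ⊆-chain-mono X X-⊆-suc

    EventuallyConstant : Set
    EventuallyConstant = ∃ λ N → 1 ≤ N × (∀ n → N ≤ n → X n ≐ X N)

    BoundedRadius : Set
    BoundedRadius = ∃ λ N → 1 ≤ N × (∀ n → X n ⊆ Ball G X0 (r * N))

    eventuallyConstant⇒boundedRadius : EventuallyConstant → BoundedRadius
    eventuallyConstant⇒boundedRadius (N , 1≤N , const) = N , 1≤N , λ n → X⊆Ball N ∘ X⊆XN n
      where
      X⊆XN : ∀ n → X n ⊆ X N
      X⊆XN n with ≤-total N n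
      ... | inj₁ N≤n = proj₁ (const n N≤n)
      ... | inj₂ n≤N = X-mono n≤N

    boundedRadius⇒eventuallyConstant : ExcludedMiddle → LocallyFinite G → FiniteSet G X0 →
                                       BoundedRadius → EventuallyConstant
    boundedRadius⇒eventuallyConstant em lf X0-finite (M , _ , bounded)
      with Ball-finite lf X0-finite (r * M)
    ... | L , Ball⊆L with chain-within-list-stabilises em X X-mono L (λ n → Ball⊆L ∘ bounded n) 1
    ... | N , 1≤N , shrink = N , 1≤N , λ n N≤n → shrink n N≤n , X-mono N≤n

proposition1p4 : ((P : Set) → Dec P) →
    (G : Graph) → LocallyFinite G →
    (r : ℕ) → 1 ≤ r →
    (f : ℕ → ℕ) →
    (X0 : Pred (Graph.V G) 0ℓ) → FiniteSet G X0 →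
    (W : ℕ → Pred (Graph.V G) 0ℓ) →
    (∀ n → 1 ≤ n → CardLe G (W n) (f n)) →
    (∀ n → Empty (Xseq G r X0 W n ∩ W (suc n))) →
    ((∃ λ N → 1 ≤ N × (∀ n → N ≤ n → Xseq G r X0 W n ≐ Xseq G r X0 W N))
    ⇔ (∃ λ N → 1 ≤ N × (∀ n → Xseq G r X0 W n ⊆ Ball G X0 (r * N))))
proposition1p4 em G lf r _ _ X0 X0-finite W _ disjoint =
  mk⇔ (eventuallyConstant⇒boundedRadius disjoint)
      (boundedRadius⇒eventuallyConstant disjoint em lf X0-finite)
  where open ContainmentSequence G r X0 W
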